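{- Let $p$ be a prime, $n$ a positive integer and $s$ a nonnegative integer. Let $\underline{a}=(a_0,a_1,\ldots)$ be an almost $p$-ary sequence of period $n+s$ with $s$ zero-symbols occupying $s$ consecutive positions. Let $\ell$ be the number of distinct elements in the set $\{C_{\underline{a}}(1),C_{\underline{a}}(2),\ldots,C_{\underline{a}}(n+s-1)\}$. Then $$\min\{s,p,n\}\le \ell\le n-1+\min\{n,s\}.$$
   Context: $\zeta_p\in\mathbb{C}$ is a fixed primitive $p$-th root of unity. An almost $p$-ary sequence of period $N$ with $s$ zero-symbols is a periodic complex sequence of period $N$ such that in one period exactly $s$ entries are $0$ and every other entry is of the form $\zeta_p^{b}$ for some integer $b$. The autocorrelation function of a sequence $\underline{a}$ of period $N$ is $C_{\underline{a}}(t)=\sum_{i=0}^{N-1}a_i\overline{a_{i+t}}$ (indices modulo $N$, bar denoting complex conjugation). -}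

module Defs where

open import Data.Nat using (ℕ; zero; suc; _+_; _∸_; _<_)
open import Data.Nat.DivMod using (_mod_)
open import Data.Fin using (Fin; toℕ)
open import Data.Fin.Properties using () renaming (_≟_ to _≟ᶠ_)
open import Data.Integer using (ℤ; 0ℤ; 1ℤ) renaming (_+_ to _+ℤ_; _*_ to _*ℤ_; _-_ to _-ℤ_)
import Data.Integer.Properties as ℤP
open import Data.List using (List; map; foldr; allFin; length; deduplicate; drop)
open import Data.Maybe using (Maybe; just; nothing)
open import Data.Product using (Σ; ∃; _×_; _,_)
open import Function.Bundles using (_⇔_)
open import Relation.Binary.PropositionalEquality using (_≡_)
open import Relation.Nullary using (Dec; yes; no)
open import Relation.Nullary.Decidable using (map′)
open import Data.Fin.Properties using (all?)

shiftF : ∀ {N} → Fin N → ℕ → Fin N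
shiftF {suc N} i t = (toℕ i + t) mod suc N

negF : ∀ {p} → Fin p → Fin p
negF {suc p} k = (suc p ∸ toℕ k) mod suc p

subF : ∀ {p} → Fin p → Fin p → Fin p
subF j k = shiftF j (toℕ (negF k))

ΣF : ∀ {N} {A : Set} → (A → A → A) → A → (Fin N → A) → A
ΣF _⊕_ e f = foldr _⊕_ e (map f (allFin _))

-- The cyclotomic integers ℤ[ζ_p] modelled as the group ring ℤ[C_p] (vectors of
-- coefficients of ζ^0,…,ζ^(p-1)) modulo the kernel of ζ ↦ ζ_p, i.e. modulo
-- multiples of 1+ζ+…+ζ^(p-1) (= constant vectors), for p prime.
Cyc : ℕ → Set
Cyc p = Fin p → ℤ

zeroC : ∀ {p} → Cyc p
zeroC _ = 0ℤ

_+C_ : ∀ {p} → Cyc p → Cyc p → Cyc p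
(u +C v) k = u k +ℤ v k

_*C_ : ∀ {p} → Cyc p → Cyc p → Cyc p
(u *C v) k = ΣF _+ℤ_ 0ℤ (λ j → u j *ℤ v (subF k j))

conjC : ∀ {p} → Cyc p → Cyc p
conjC u k = u (negF k)

zetaPow : ∀ {p} → Fin p → Cyc p
zetaPow b k with b ≟ᶠ k
... | yes _ = 1ℤ
... | no _ = 0ℤ

_≈C_ : ∀ {p} → Cyc p → Cyc p → Set
_≈C_ {p} u v = ∃ λ c → (k : Fin p) → u k -ℤ v k ≡ c

_≈C?_ : ∀ {p} → (u v : Cyc p) → Dec (u ≈C v)
_≈C?_ {zero} u v = yes (0ℤ , λ ())
_≈C?_ {suc p} u v =
  map′ (λ h → (u Fin.zero -ℤ v Fin.zero) , h)
       (λ { (c , h) → λ k → Relation.Binary.PropositionalEquality.trans (h k) (Relation.Binary.PropositionalEquality.sym (h Fin.zero)) })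
       (all? (λ k → (u k -ℤ v k) ℤP.≟ (u Fin.zero -ℤ v Fin.zero)))
  where import Data.Fin as Fin

-- An almost p-ary sequence of period N: one period, entry nothing = 0, just b = ζ_p^b
Seq : ℕ → ℕ → Set
Seq p N = Fin N → Maybe (Fin p)

val : ∀ {p} → Maybe (Fin p) → Cyc p
val nothing = zeroC
val (just b) = zetaPow b

autocorr : ∀ {p N} → Seq p N → ℕ → Cyc p
autocorr a t = ΣF _+C_ zeroC (λ i → val (a i) *C conjC (val (a (shiftF i t))))

ZeroBlock : ∀ {p N} → Seq p N → ℕ → Set
ZeroBlock {p} {N} a s =
  Σ (Fin N) λ j → (i : Fin N) → (a i ≡ nothing) ⇔ (∃ λ k → k < s × i ≡ shiftF j k)

shifts : ℕ → List ℕ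
shifts N = drop 1 (Data.List.upTo N)
  where import Data.List

distinctCorr : ∀ {p N} → Seq p N → ℕ
distinctCorr {p} {N} a =
  length (deduplicate _≈C?_ (map (autocorr a) (shifts N)))

-- The augmentation ℤ[ζ_p] → ℤ/pℤ, ζ_p ↦ 1, sends C(t) to the number of indices i at which
-- both a_i and a_{i+t} are nonzero; when the zeros form a block of length s this is n − t for
-- every t ≤ s. For 1 ≤ t < u ≤ min(s,p,n) these residues differ by u − t ∈ (0,p), so
-- C(1), …, C(min(s,p,n)) are pairwise distinct. For n ≤ t ≤ s every product a_i · conj(a_{i+t})
-- has a factor inside the zero block, so all these C(t) are 0: together they contribute one
-- value, which gives the upper bound.
module Submission where

open import Defs
open import Data.Nat as ℕ using (ℕ; zero; suc; _+_; _*_; _∸_; _≤_; _<_; _⊓_; z≤n; s≤s; NonZero; _%_; _/_)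
import Data.Nat.Properties as ℕₚ
open import Data.Nat.DivMod using (_mod_; m≡m%n+[m/n]*n; [m+n]%n≡m%n; %-distribˡ-+; m%n%n≡m%n; m<n⇒m%n≡m; /-monoˡ-≤)
open import Data.Nat.Divisibility using (_∣_; >⇒∤; m∣m*n)
open import Data.Nat.Primality using (Prime)
open import Data.Fin as Fin using (Fin; toℕ; opposite; punchIn)
import Data.Fin.Properties as Finₚ
open import Data.Fin.Permutation using (reverse)
open import Data.Integer using (ℤ; +_; 0ℤ; 1ℤ; ∣_∣; -_; _⊖_) renaming (_+_ to _+ℤ_; _*_ to _*ℤ_; _-_ to _-ℤ_)
import Data.Integer.Properties as ℤₚ
open import Data.Integer.Divisibility using () renaming (_∣_ to _∣ℤ_)
open import Data.Integer.Tactic.RingSolver using (solve-∀)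
open import Algebra.Bundles using (AbelianGroup)
open import Algebra.Properties.Group (AbelianGroup.group ℤₚ.+-0-abelianGroup) using (∙-cancelˡ)
open import Algebra.Properties.Semiring.Sum ℤₚ.+-*-semiring
  using (sum; sum-syntax; sum-cong-≗; sum-init-last; sum-remove; sum-replicate-zero; sum-permute;
         ∑-comm; ∑-distrib-+; *-distribˡ-sum; *-distribʳ-sum)
import Data.Vec.Functional as Vector
open import Data.List using (List; []; _∷_; _++_; length; map; foldr; tabulate; applyUpTo; deduplicate; lookup)
import Data.List.Properties as Listₚ
open import Data.List.Relation.Unary.All using (All; []; _∷_)
import Data.List.Relation.Unary.All.Properties as Allₚ
open import Data.List.Relation.Unary.Any as Any using (Any; here)
import Data.List.Relation.Unary.Any.Properties as Anyₚ
open import Data.List.Membership.Propositional.Properties using (∈-applyUpTo⁺; ∈-map⁺)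
open import Data.Maybe using (Maybe; just; nothing)
open import Data.Product using (_×_; _,_; ∃)
open import Data.Sum using (_⊎_; inj₁; inj₂)
open import Function using (_∘_; id; _⇔_; Equivalence)
open import Relation.Binary using (Rel; Decidable; IsEquivalence; tri<; tri≈; tri>)
open import Relation.Binary.PropositionalEquality
open import Relation.Nullary using (¬_; yes; no; ¬?)
open import Relation.Nullary.Negation using (contradiction)

open ≡-Reasoning

-- Finite and periodic sums

foldr-map-tabulate : ∀ {A B : Set} {n} (_⊕_ : B → B → B) (e : B) (f : A → B) (g : Fin n → A) →
                     foldr _⊕_ e (map f (tabulate g)) ≡ Vector.foldr _⊕_ e (f ∘ g)
foldr-map-tabulate {n = zero}  _⊕_ e f g = refl
foldr-map-tabulate {n = suc n} _⊕_ e f g =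
  cong (f (g Fin.zero) ⊕_) (foldr-map-tabulate _⊕_ e f (g ∘ Fin.suc))

ΣF≡sum : ∀ {n} (f : Fin n → ℤ) → ΣF _+ℤ_ 0ℤ f ≡ sum f
ΣF≡sum f = foldr-map-tabulate _+ℤ_ 0ℤ f id

ΣF-+C-apply : ∀ {p n} (F : Fin n → Cyc p) (k : Fin p) → ΣF _+C_ zeroC F k ≡ ∑[ i < n ] F i k
ΣF-+C-apply F k = go F id
  where
  go : ∀ {A : Set} {n} (F : A → Cyc _) (g : Fin n → A) →
       foldr _+C_ zeroC (map F (tabulate g)) k ≡ ∑[ i < n ] F (g i) k
  go {n = zero}  F g = refl
  go {n = suc n} F g = cong (F (g Fin.zero) k +ℤ_) (go F (g ∘ Fin.suc))

sum-const : ∀ n (c : ℤ) → ∑[ i < n ] c ≡ + n *ℤ c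
sum-const zero    c = refl
sum-const (suc n) c = begin
  c +ℤ ∑[ i < n ] c      ≡⟨ cong₂ _+ℤ_ (sym (ℤₚ.*-identityˡ c)) (sum-const n c) ⟩
  1ℤ *ℤ c +ℤ + n *ℤ c   ≡⟨ ℤₚ.*-distribʳ-+ c 1ℤ (+ n) ⟨
  + suc n *ℤ c          ∎

⟦_<_⟧ : ℕ → ℕ → ℤ
⟦ _     < zero  ⟧ = 0ℤ
⟦ zero  < suc _ ⟧ = 1ℤ
⟦ suc m < suc n ⟧ = ⟦ m < n ⟧

⟦<⟧-yes : ∀ {m n} → m < n → ⟦ m < n ⟧ ≡ 1ℤ
⟦<⟧-yes {zero}  {suc n} _         = refl
⟦<⟧-yes {suc m} {suc n} (s≤s m<n) = ⟦<⟧-yes m<n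

⟦<⟧-no : ∀ {m n} → n ≤ m → ⟦ m < n ⟧ ≡ 0ℤ
⟦<⟧-no {m}     {zero}  _         = refl
⟦<⟧-no {suc m} {suc n} (s≤s n≤m) = ⟦<⟧-no n≤m

⟦+<⟧≡⟦<∸⟧ : ∀ m t n → ⟦ m + t < n ⟧ ≡ ⟦ m < n ∸ t ⟧
⟦+<⟧≡⟦<∸⟧ m zero    n       = cong ⟦_< n ⟧ (ℕₚ.+-identityʳ m)
⟦+<⟧≡⟦<∸⟧ m (suc t) zero    = refl
⟦+<⟧≡⟦<∸⟧ m (suc t) (suc n) = trans (cong ⟦_< suc n ⟧ (ℕₚ.+-suc m t)) (⟦+<⟧≡⟦<∸⟧ m t n)

∑-⟦<⟧ : ∀ {N k} → k ≤ N → ∑[ i < N ] ⟦ toℕ i < k ⟧ ≡ + k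
∑-⟦<⟧ {zero}  z≤n       = refl
∑-⟦<⟧ {suc N} z≤n       = sum-replicate-zero (suc N)
∑-⟦<⟧ {suc N} (s≤s k≤N) = cong (1ℤ +ℤ_) (∑-⟦<⟧ k≤N)

Periodic : ℕ → (ℕ → ℤ) → Set
Periodic N h = ∀ m → h (m + N) ≡ h m

-- Summing over one more index both prepends h 0 and appends h N = h 0.
∑-periodic-suc : ∀ {N h} → Periodic N h → ∑[ i < N ] h (suc (toℕ i)) ≡ ∑[ i < N ] h (toℕ i)
∑-periodic-suc {N} {h} per = ∙-cancelˡ (h 0) _ _ (begin
  h 0 +ℤ ∑[ i < N ] h (suc (toℕ i))                       ≡⟨ sum-init-last {N} (h ∘ toℕ) ⟩
  ∑[ i < N ] h (toℕ (Fin.inject₁ i)) +ℤ h (toℕ (Fin.fromℕ N)) ≡⟨ cong₂ _+ℤ_ (sum-cong-≗ {N} (λ i → cong h (Finₚ.toℕ-inject₁ i)))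
                                                                             (cong h (Finₚ.toℕ-fromℕ N)) ⟩
  ∑[ i < N ] h (toℕ i) +ℤ h N                             ≡⟨ cong (∑[ i < N ] h (toℕ i) +ℤ_) (per 0) ⟩
  ∑[ i < N ] h (toℕ i) +ℤ h 0                             ≡⟨ ℤₚ.+-comm _ (h 0) ⟩
  h 0 +ℤ ∑[ i < N ] h (toℕ i)                             ∎)

∑-periodic-shift : ∀ {N h} → Periodic N h → ∀ c → ∑[ i < N ] h (c + toℕ i) ≡ ∑[ i < N ] h (toℕ i)
∑-periodic-shift per zero    = refl
∑-periodic-shift per (suc c) = trans (∑-periodic-shift (per ∘ suc) c) (∑-periodic-suc per)

∑-periodic-reverse : ∀ {N h} → Periodic N h → ∑[ i < N ] h (N ∸ toℕ i) ≡ ∑[ i < N ] h (toℕ i)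
∑-periodic-reverse {zero}      per = refl
∑-periodic-reverse {suc N} {h} per = begin
  ∑[ i < suc N ] h (suc N ∸ toℕ i)          ≡⟨ sum-cong-≗ (λ i → cong h (reflect i)) ⟩
  ∑[ i < suc N ] h (suc (toℕ (opposite i))) ≡⟨ sum-permute (h ∘ suc ∘ toℕ) reverse ⟨
  ∑[ i < suc N ] h (suc (toℕ i))            ≡⟨ ∑-periodic-suc per ⟩
  ∑[ i < suc N ] h (toℕ i)                  ∎
  where
  reflect : (i : Fin (suc N)) → suc N ∸ toℕ i ≡ suc (toℕ (opposite i))
  reflect i = trans (ℕₚ.+-∸-assoc 1 (Finₚ.toℕ≤pred[n] i)) (cong suc (sym (Finₚ.opposite-prop i)))

-- Cyclic index arithmetic

toℕ-mod : ∀ m n .{{_ : NonZero n}} → toℕ (m mod n) ≡ m % n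
toℕ-mod m n = Finₚ.toℕ-fromℕ< _

mod-toℕ : ∀ {n} (i : Fin (suc n)) → toℕ i mod suc n ≡ i
mod-toℕ {n} i = Finₚ.toℕ-injective (trans (toℕ-mod (toℕ i) (suc n)) (m<n⇒m%n≡m (Finₚ.toℕ<n i)))

mod-periodic : ∀ m n .{{_ : NonZero n}} → (m + n) mod n ≡ m mod n
mod-periodic m n = Finₚ.toℕ-injective (begin
  toℕ ((m + n) mod n) ≡⟨ toℕ-mod (m + n) n ⟩
  (m + n) % n         ≡⟨ [m+n]%n≡m%n m n ⟩
  m % n               ≡⟨ toℕ-mod m n ⟨
  toℕ (m mod n)       ∎)

[m%n+k]%n≡[m+k]%n : ∀ m k n .{{_ : NonZero n}} → (m % n + k) % n ≡ (m + k) % n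
[m%n+k]%n≡[m+k]%n m k n = begin
  (m % n + k) % n         ≡⟨ %-distribˡ-+ (m % n) k n ⟩
  (m % n % n + k % n) % n ≡⟨ cong (λ x → (x + k % n) % n) (m%n%n≡m%n m n) ⟩
  (m % n + k % n) % n     ≡⟨ %-distribˡ-+ m k n ⟨
  (m + k) % n             ∎

%-injective : ∀ {x y} n .{{_ : NonZero n}} → x % n ≡ y % n → x ≤ y → y < x + n → x ≡ y
%-injective {x} {y} n x%n≡y%n x≤y y<x+n = sym (begin
  y         ≡⟨ y≡x+q*n ⟩
  x + q * n ≡⟨ cong (λ c → x + c * n) q≡0 ⟩
  x + 0     ≡⟨ ℕₚ.+-identityʳ x ⟩
  x         ∎)
  where
  q : ℕ
  q = y / n ∸ x / n
  y≡x+q*n : y ≡ x + q * n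
  y≡x+q*n = begin
    y                         ≡⟨ m≡m%n+[m/n]*n y n ⟩
    y % n + y / n * n         ≡⟨ cong₂ (λ r c → r + c * n) (sym x%n≡y%n) (sym (ℕₚ.m+[n∸m]≡n (/-monoˡ-≤ n x≤y))) ⟩
    x % n + (x / n + q) * n   ≡⟨ cong (λ z → x % n + z) (ℕₚ.*-distribʳ-+ n (x / n) q) ⟩
    x % n + (x / n * n + q * n) ≡⟨ ℕₚ.+-assoc (x % n) _ _ ⟨
    x % n + x / n * n + q * n ≡⟨ cong (_+ q * n) (m≡m%n+[m/n]*n x n) ⟨
    x + q * n                 ∎
  q≡0 : q ≡ 0
  q≡0 = ℕₚ.n<1⇒n≡0 (ℕₚ.*-cancelʳ-< n q 1
          (ℕₚ.+-cancelˡ-< x (q * n) (1 * n) (subst (_< x + 1 * n) y≡x+q*n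
            (subst (λ c → y < x + c) (sym (ℕₚ.*-identityˡ n)) y<x+n))))

shiftF-shiftF : ∀ {n} (i : Fin n) c t → shiftF (shiftF i c) t ≡ shiftF i (c + t)
shiftF-shiftF {suc n} i c t = Finₚ.toℕ-injective (begin
  toℕ (shiftF (shiftF i c) t)               ≡⟨ toℕ-mod (toℕ (shiftF i c) + t) (suc n) ⟩
  (toℕ ((toℕ i + c) mod suc n) + t) % suc n ≡⟨ cong (λ x → (x + t) % suc n) (toℕ-mod (toℕ i + c) (suc n)) ⟩
  ((toℕ i + c) % suc n + t) % suc n         ≡⟨ [m%n+k]%n≡[m+k]%n (toℕ i + c) t (suc n) ⟩
  (toℕ i + c + t) % suc n                   ≡⟨ cong (_% suc n) (ℕₚ.+-assoc (toℕ i) c t) ⟩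
  (toℕ i + (c + t)) % suc n                 ≡⟨ toℕ-mod (toℕ i + (c + t)) (suc n) ⟨
  toℕ (shiftF i (c + t))                    ∎)

shiftF-periodic : ∀ {n} (i : Fin n) c → shiftF i (c + n) ≡ shiftF i c
shiftF-periodic {suc n} i c =
  trans (cong (_mod suc n) (sym (ℕₚ.+-assoc (toℕ i) c (suc n)))) (mod-periodic (toℕ i + c) (suc n))

+-%-injective : ∀ c {k l} n .{{_ : NonZero n}} → k < n → l < n → (c + k) % n ≡ (c + l) % n → k ≡ l
+-%-injective c {k} {l} n k<n l<n eq with ℕₚ.≤-total k l
... | inj₁ k≤l = ℕₚ.+-cancelˡ-≡ c k l (%-injective n eq (ℕₚ.+-monoʳ-≤ c k≤l)
      (ℕₚ.<-≤-trans (ℕₚ.+-monoʳ-< c l<n) (ℕₚ.+-monoˡ-≤ n (ℕₚ.m≤m+n c k))))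
... | inj₂ l≤k = ℕₚ.+-cancelˡ-≡ c k l (sym (%-injective n (sym eq) (ℕₚ.+-monoʳ-≤ c l≤k)
      (ℕₚ.<-≤-trans (ℕₚ.+-monoʳ-< c k<n) (ℕₚ.+-monoˡ-≤ n (ℕₚ.m≤m+n c l)))))

shiftF-injective : ∀ {n} (j : Fin n) {k l} → k < n → l < n → shiftF j k ≡ shiftF j l → k ≡ l
shiftF-injective {suc n} j {k} {l} k<n l<n eq = +-%-injective (toℕ j) (suc n) k<n l<n
  (trans (sym (toℕ-mod (toℕ j + k) (suc n))) (trans (cong toℕ eq) (toℕ-mod (toℕ j + l) (suc n))))

periodic-mod : ∀ {n} (f : Fin (suc n) → ℤ) → Periodic (suc n) (λ m → f (m mod suc n))
periodic-mod {n} f m = cong f (mod-periodic m (suc n))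

sum-shiftF : ∀ {n} (f : Fin n → ℤ) c → ∑[ i < n ] f (shiftF i c) ≡ sum f
sum-shiftF {zero}  f c = refl
sum-shiftF {suc n} f c = begin
  ∑[ i < suc n ] f ((toℕ i + c) mod suc n) ≡⟨ sum-cong-≗ {suc n} (λ i → cong (λ x → f (x mod suc n)) (ℕₚ.+-comm (toℕ i) c)) ⟩
  ∑[ i < suc n ] f ((c + toℕ i) mod suc n) ≡⟨ ∑-periodic-shift (periodic-mod f) c ⟩
  ∑[ i < suc n ] f (toℕ i mod suc n)       ≡⟨ sum-cong-≗ {suc n} (λ i → cong f (mod-toℕ i)) ⟩
  sum f                                    ∎

sum-negF : ∀ {n} (f : Fin n → ℤ) → ∑[ i < n ] f (negF i) ≡ sum f
sum-negF {zero}  f = refl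
sum-negF {suc n} f =
  trans (∑-periodic-reverse (periodic-mod f)) (sum-cong-≗ {suc n} (λ i → cong f (mod-toℕ i)))

shiftF-exchange : ∀ {N} (i j : Fin N) c → shiftF i (toℕ j + c) ≡ shiftF j (c + toℕ i)
shiftF-exchange {suc N} i j c =
  cong (_mod suc N) (trans (ℕₚ.+-comm (toℕ i) (toℕ j + c)) (ℕₚ.+-assoc (toℕ j) c (toℕ i)))

∑-rotate-pairs : ∀ {A : Set} {N} (H : A → A → ℤ) (a : Fin N → A) (j : Fin N) (c t : ℕ) →
  ∑[ i < N ] H (a i) (a (shiftF i t)) ≡
  ∑[ i < N ] H (a (shiftF j (c + toℕ i))) (a (shiftF j (c + (toℕ i + t))))
∑-rotate-pairs {N = N} H a j c t = begin
  sum pair                                ≡⟨ sum-shiftF pair (toℕ j + c) ⟨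
  ∑[ i < N ] pair (shiftF i (toℕ j + c))  ≡⟨ sum-cong-≗ {N} (λ i → cong pair (shiftF-exchange i j c)) ⟩
  ∑[ i < N ] pair (shiftF j (c + toℕ i))  ≡⟨ sum-cong-≗ {N} (λ i → cong (H (a (shiftF j (c + toℕ i))) ∘ a) (shifted i)) ⟩
  ∑[ i < N ] H (a (shiftF j (c + toℕ i))) (a (shiftF j (c + (toℕ i + t)))) ∎
  where
  pair : Fin N → ℤ
  pair i = H (a i) (a (shiftF i t))
  shifted : ∀ i → shiftF (shiftF j (c + toℕ i)) t ≡ shiftF j (c + (toℕ i + t))
  shifted i = trans (shiftF-shiftF j (c + toℕ i) t) (cong (shiftF j) (ℕₚ.+-assoc c (toℕ i) t))

-- The augmentation ζ^b ↦ 1 of ℤ[C_p]. On ℤ[ζ_p] it is only defined modulo p, since the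
-- constant vectors, which _≈C_ identifies with 0, have augmentations divisible by p.
augmentation : ∀ {p} → Cyc p → ℤ
augmentation u = sum u

augmentation-*C : ∀ {p} (u v : Cyc p) → augmentation (u *C v) ≡ augmentation u *ℤ augmentation v
augmentation-*C {p} u v = begin
  ∑[ k < p ] ΣF _+ℤ_ 0ℤ (λ j → u j *ℤ v (subF k j)) ≡⟨ sum-cong-≗ {p} (λ k → ΣF≡sum (λ j → u j *ℤ v (subF k j))) ⟩
  ∑[ k < p ] ∑[ j < p ] (u j *ℤ v (subF k j))      ≡⟨ ∑-comm (λ k j → u j *ℤ v (subF k j)) ⟩
  ∑[ j < p ] ∑[ k < p ] (u j *ℤ v (subF k j))      ≡⟨ sum-cong-≗ {p} (λ j → *-distribˡ-sum (u j) (λ k → v (subF k j))) ⟨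
  ∑[ j < p ] (u j *ℤ ∑[ k < p ] v (subF k j))      ≡⟨ sum-cong-≗ {p} (λ j → cong (u j *ℤ_) (sum-shiftF v (toℕ (negF j)))) ⟩
  ∑[ j < p ] (u j *ℤ sum v)                        ≡⟨ *-distribʳ-sum (sum v) u ⟨
  sum u *ℤ sum v                                   ∎

augmentation-conjC : ∀ {p} (u : Cyc p) → augmentation (conjC u) ≡ augmentation u
augmentation-conjC = sum-negF

zetaPow-diagonal : ∀ {p} (b : Fin p) → zetaPow b b ≡ 1ℤ
zetaPow-diagonal b with b Finₚ.≟ b
... | yes _   = refl
... | no b≢b = contradiction refl b≢b

zetaPow-off-diagonal : ∀ {p} {b k : Fin p} → b ≢ k → zetaPow b k ≡ 0ℤ
zetaPow-off-diagonal {b = b} {k} b≢k with b Finₚ.≟ k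
... | yes b≡k = contradiction b≡k b≢k
... | no _    = refl

augmentation-zetaPow : ∀ {p} (b : Fin p) → augmentation (zetaPow b) ≡ 1ℤ
augmentation-zetaPow {suc p} b = begin
  sum (zetaPow b)                                   ≡⟨ sum-remove {i = b} (zetaPow b) ⟩
  zetaPow b b +ℤ ∑[ j < p ] zetaPow b (punchIn b j) ≡⟨ cong₂ _+ℤ_ (zetaPow-diagonal b)
                                                         (sum-cong-≗ {p} (λ j → zetaPow-off-diagonal (Finₚ.punchInᵢ≢i b j ∘ sym))) ⟩
  1ℤ +ℤ ∑[ j < p ] 0ℤ                               ≡⟨ cong (1ℤ +ℤ_) (sum-replicate-zero p) ⟩
  1ℤ                                                ∎

occupied : ∀ {A : Set} → Maybe A → ℤ
occupied nothing  = 0ℤ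
occupied (just _) = 1ℤ

occupied-nonzero : ∀ {A : Set} {x : Maybe A} → x ≢ nothing → occupied x ≡ 1ℤ
occupied-nonzero {x = nothing} x≢nothing = contradiction refl x≢nothing
occupied-nonzero {x = just _}  _         = refl

augmentation-val : ∀ {p} (x : Maybe (Fin p)) → augmentation (val x) ≡ occupied x
augmentation-val {p} nothing  = sum-replicate-zero p
augmentation-val     (just b) = augmentation-zetaPow b

augmentation-autocorr : ∀ {p N} (a : Seq p N) t →
  augmentation (autocorr a t) ≡ ∑[ i < N ] (occupied (a i) *ℤ occupied (a (shiftF i t)))
augmentation-autocorr {p} {N} a t = begin
  ∑[ k < p ] autocorr a t k        ≡⟨ sum-cong-≗ {p} (ΣF-+C-apply term) ⟩
  ∑[ k < p ] ∑[ i < N ] term i k   ≡⟨ ∑-comm (λ k i → term i k) ⟩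
  ∑[ i < N ] augmentation (term i) ≡⟨ sum-cong-≗ {N} augmentation-term ⟩
  ∑[ i < N ] (occupied (a i) *ℤ occupied (a (shiftF i t))) ∎
  where
  term : Fin N → Cyc p
  term i = val (a i) *C conjC (val (a (shiftF i t)))
  augmentation-term : ∀ i → augmentation (term i) ≡ occupied (a i) *ℤ occupied (a (shiftF i t))
  augmentation-term i = trans (augmentation-*C (val (a i)) (conjC (val (a (shiftF i t))))) (cong₂ _*ℤ_ (augmentation-val (a i))
    (trans (augmentation-conjC (val (a (shiftF i t)))) (augmentation-val (a (shiftF i t)))))

≈C-isEquivalence : ∀ {p} → IsEquivalence (_≈C_ {p})
≈C-isEquivalence = record
  { refl  = λ {u} → 0ℤ , λ k → ℤₚ.+-inverseʳ (u k)
  ; sym   = λ {u} {v} (c , u-v≡c) → - c , λ k → trans (swap-minus (u k) (v k)) (cong -_ (u-v≡c k))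
  ; trans = λ {u} {v} {w} (c , u-v≡c) (d , v-w≡d) →
              c +ℤ d , λ k → trans (sym (ℤₚ.+-minus-telescope (u k) (v k) (w k))) (cong₂ _+ℤ_ (u-v≡c k) (v-w≡d k))
  }
  where
  swap-minus : ∀ x y → y -ℤ x ≡ - (x -ℤ y)
  swap-minus = solve-∀

module ≈C {p} = IsEquivalence (≈C-isEquivalence {p})

≈C⇒∣augmentation-difference : ∀ {p} {u v : Cyc p} → u ≈C v → + p ∣ℤ augmentation u -ℤ augmentation v
≈C⇒∣augmentation-difference {p} {u} {v} (c , u-v≡c) =
  subst (p ∣_) (sym (trans (cong ∣_∣ difference) (ℤₚ.abs-* (+ p) c))) (m∣m*n ∣ c ∣)
  where
  shift-by-difference : ∀ x y → x ≡ y +ℤ (x -ℤ y)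
  shift-by-difference = solve-∀
  cancel : ∀ x y → (x +ℤ y) -ℤ x ≡ y
  cancel = solve-∀
  difference : augmentation u -ℤ augmentation v ≡ + p *ℤ c
  difference = begin
    sum u -ℤ sum v                       ≡⟨ cong (_-ℤ sum v) (sum-cong-≗ {p} (λ k → trans (shift-by-difference (u k) (v k)) (cong (v k +ℤ_) (u-v≡c k)))) ⟩
    ∑[ k < p ] (v k +ℤ c) -ℤ sum v       ≡⟨ cong (_-ℤ sum v) (∑-distrib-+ v (λ _ → c)) ⟩
    (sum v +ℤ ∑[ k < p ] c) -ℤ sum v     ≡⟨ cancel (sum v) (∑[ k < p ] c) ⟩
    ∑[ k < p ] c                         ≡⟨ sum-const p c ⟩
    + p *ℤ c                             ∎

val-*C-conjC-vanishes : ∀ {p} {x y : Maybe (Fin p)} → x ≡ nothing ⊎ y ≡ nothing →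
                    ∀ k → (val x *C conjC (val y)) k ≡ 0ℤ
val-*C-conjC-vanishes {p} {x} {y} zero-factor k = begin
  ΣF _+ℤ_ 0ℤ (λ j → val x j *ℤ val y (negF (subF k j))) ≡⟨ ΣF≡sum {p} _ ⟩
  ∑[ j < p ] (val x j *ℤ val y (negF (subF k j)))       ≡⟨ sum-cong-≗ {p} (λ j → product-zero zero-factor) ⟩
  ∑[ j < p ] 0ℤ                                         ≡⟨ sum-replicate-zero p ⟩
  0ℤ                                                    ∎
  where
  product-zero : ∀ {x y : Maybe (Fin p)} {j l} → x ≡ nothing ⊎ y ≡ nothing → val x j *ℤ val y l ≡ 0ℤ
  product-zero (inj₁ refl) = refl
  product-zero {x} {j = j} (inj₂ refl) = ℤₚ.*-zeroʳ (val x j)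

-- Counting distinct elements up to an equivalence

module _ {a ℓ} {A : Set a} {_≈_ : Rel A ℓ} (≈-isEquivalence : IsEquivalence _≈_) (_≈?_ : Decidable _≈_) where

  open IsEquivalence ≈-isEquivalence using () renaming (sym to ≈-sym; trans to ≈-trans)

  private
    dedup : List A → List A
    dedup = deduplicate _≈?_

  deduplicate-represents : ∀ {x xs} → Any (x ≈_) xs → Any (x ≈_) (dedup xs)
  deduplicate-represents = Anyₚ.deduplicate⁺ _≈?_ (λ z≈y x≈y → ≈-trans x≈y (≈-sym z≈y))

  length-deduplicate-++ : ∀ xs ys → length (dedup (xs ++ ys)) ≤ length xs + length (dedup ys)
  length-deduplicate-++ []       ys = ℕₚ.≤-refl
  length-deduplicate-++ (x ∷ xs) ys =
    s≤s (ℕₚ.≤-trans (Listₚ.length-filter (¬? ∘ (x ≈?_)) (dedup (xs ++ ys))) (length-deduplicate-++ xs ys))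

  length-deduplicate-redundant : ∀ xs ys → All (λ x → Any (x ≈_) ys) xs →
                                 length (dedup (xs ++ ys)) ≤ length (dedup ys)
  length-deduplicate-redundant []       ys []                = ℕₚ.≤-refl
  length-deduplicate-redundant (x ∷ xs) ys (x∈ys ∷ xs⊆ys) = ℕₚ.≤-trans
    (Listₚ.filter-notAll (¬? ∘ (x ≈?_)) (dedup (xs ++ ys))
      (Any.map (λ x≈y x≉y → x≉y x≈y) (deduplicate-represents (Anyₚ.++⁺ʳ xs x∈ys))))
    (length-deduplicate-redundant xs ys xs⊆ys)

  ≤-length-deduplicate : ∀ {m} xs (f : Fin m → A) → (∀ i → Any (f i ≈_) xs) →
                         (∀ {i j} → f i ≈ f j → i ≡ j) → m ≤ length (dedup xs)
  ≤-length-deduplicate {m} xs f f∈xs f-injective = Finₚ.injective⇒≤ index-injective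
    where
    index : Fin m → Fin (length (dedup xs))
    index i = Any.index (deduplicate-represents (f∈xs i))
    index-injective : ∀ {i j} → index i ≡ index j → i ≡ j
    index-injective {i} {j} eq = f-injective (≈-trans
      (subst (λ k → f i ≈ lookup (dedup xs) k) eq (Anyₚ.lookup-index (deduplicate-represents (f∈xs i))))
      (≈-sym (Anyₚ.lookup-index (deduplicate-represents (f∈xs j)))))

applyUpTo-++ : ∀ {A : Set} (f : ℕ → A) m k → applyUpTo f (m + k) ≡ applyUpTo f m ++ applyUpTo (λ x → f (m + x)) k
applyUpTo-++ f zero    k = refl
applyUpTo-++ f (suc m) k = cong (f 0 ∷_) (applyUpTo-++ (f ∘ suc) m k)

-- Sequences whose zeros form one block

module WithZeroBlock {p n-1 s : ℕ} (a : Seq p (suc n-1 + s)) (j : Fin (suc n-1 + s))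
  (zeros : (i : Fin (suc n-1 + s)) → (a i ≡ nothing) ⇔ (∃ λ k → k < s × i ≡ shiftF j k)) where

  n N : ℕ
  n = suc n-1
  N = n + s

  inside-block : ∀ {k} → k < s → a (shiftF j k) ≡ nothing
  inside-block k<s = Equivalence.from (zeros _) (_ , k<s , refl)

  outside-block : ∀ {k} → s ≤ k → k < N → a (shiftF j k) ≢ nothing
  outside-block s≤k k<N a≡nothing with Equivalence.to (zeros _) a≡nothing
  ... | l , l<s , eq = ℕₚ.<⇒≱ l<s (subst (s ≤_) (shiftF-injective j k<N (ℕₚ.<-≤-trans l<s (ℕₚ.m≤n+m s n)) eq) s≤k)

  -- The sequence read from just after the zero block, which thereby occupies [n, N).
  rotated : ℕ → Maybe (Fin p)
  rotated m = a (shiftF j (s + m))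

  rotated-zero : ∀ {m} → n ≤ m → m < N → rotated m ≡ nothing
  rotated-zero {m} n≤m m<N = begin
    a (shiftF j (s + m))           ≡⟨ cong (a ∘ shiftF j) s+m≡k+N ⟩
    a (shiftF j (m ∸ n + N))       ≡⟨ cong a (shiftF-periodic j (m ∸ n)) ⟩
    a (shiftF j (m ∸ n))           ≡⟨ inside-block (ℕₚ.+-cancelˡ-< n (m ∸ n) s (subst (_< N) (sym (ℕₚ.m+[n∸m]≡n n≤m)) m<N)) ⟩
    nothing                        ∎
    where
    s+m≡k+N : s + m ≡ m ∸ n + N
    s+m≡k+N = begin
      s + m             ≡⟨ cong (λ x → s + x) (ℕₚ.m∸n+n≡m n≤m) ⟨
      s + (m ∸ n + n)   ≡⟨ ℕₚ.+-comm s (m ∸ n + n) ⟩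
      m ∸ n + n + s     ≡⟨ ℕₚ.+-assoc (m ∸ n) n s ⟩
      m ∸ n + N         ∎

  occupied-rotated : ∀ {m} → m < N → occupied (rotated m) ≡ ⟦ m < n ⟧
  occupied-rotated {m} m<N with m ℕₚ.<? n
  ... | yes m<n = trans (occupied-nonzero (outside-block (ℕₚ.m≤m+n s m) s+m<N)) (sym (⟦<⟧-yes m<n))
    where
    s+m<N : s + m < N
    s+m<N = subst (s + m <_) (ℕₚ.+-comm s n) (ℕₚ.+-monoʳ-< s m<n)
  ... | no m≮n = trans (cong occupied (rotated-zero (ℕₚ.≮⇒≥ m≮n) m<N)) (sym (⟦<⟧-no (ℕₚ.≮⇒≥ m≮n)))

  occupied-overlap : ∀ {t m} → t ≤ s → m < N →
                     occupied (rotated m) *ℤ occupied (rotated (m + t)) ≡ ⟦ m < n ∸ t ⟧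
  occupied-overlap {t} {m} t≤s m<N with m ℕₚ.<? n
  ... | yes m<n = begin
    occupied (rotated m) *ℤ occupied (rotated (m + t)) ≡⟨ cong₂ _*ℤ_ (occupied-rotated m<N) (occupied-rotated (ℕₚ.+-mono-<-≤ m<n t≤s)) ⟩
    ⟦ m < n ⟧ *ℤ ⟦ m + t < n ⟧                         ≡⟨ cong (_*ℤ ⟦ m + t < n ⟧) (⟦<⟧-yes m<n) ⟩
    1ℤ *ℤ ⟦ m + t < n ⟧                                ≡⟨ ℤₚ.*-identityˡ _ ⟩
    ⟦ m + t < n ⟧                                      ≡⟨ ⟦+<⟧≡⟦<∸⟧ m t n ⟩
    ⟦ m < n ∸ t ⟧                                      ∎
  ... | no m≮n = begin
    occupied (rotated m) *ℤ occupied (rotated (m + t)) ≡⟨ cong (λ x → occupied x *ℤ occupied (rotated (m + t))) (rotated-zero n≤m m<N) ⟩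
    0ℤ                                                 ≡⟨ ⟦<⟧-no (ℕₚ.≤-trans (ℕₚ.m∸n≤m n t) n≤m) ⟨
    ⟦ m < n ∸ t ⟧                                      ∎
    where
    n≤m : n ≤ m
    n≤m = ℕₚ.≮⇒≥ m≮n

  augmentation-autocorr-within-block : ∀ {t} → t ≤ s → augmentation (autocorr a t) ≡ + (n ∸ t)
  augmentation-autocorr-within-block {t} t≤s = begin
    augmentation (autocorr a t)                                          ≡⟨ augmentation-autocorr a t ⟩
    ∑[ i < N ] (occupied (a i) *ℤ occupied (a (shiftF i t)))             ≡⟨ ∑-rotate-pairs (λ x y → occupied x *ℤ occupied y) a j s t ⟩
    ∑[ i < N ] (occupied (rotated (toℕ i)) *ℤ occupied (rotated (toℕ i + t))) ≡⟨ sum-cong-≗ {N} (λ i → occupied-overlap t≤s (Finₚ.toℕ<n i)) ⟩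
    ∑[ i < N ] ⟦ toℕ i < n ∸ t ⟧                                         ≡⟨ ∑-⟦<⟧ (ℕₚ.≤-trans (ℕₚ.m∸n≤m n t) (ℕₚ.m≤m+n n s)) ⟩
    + (n ∸ t)                                                            ∎

  autocorr-vanishes : ∀ {t} → n ≤ t → t ≤ s → autocorr a t ≈C zeroC
  autocorr-vanishes {t} n≤t t≤s = 0ℤ , λ k → trans (ℤₚ.+-identityʳ _) (begin
    autocorr a t k                                                   ≡⟨ ΣF-+C-apply (λ i → val (a i) *C conjC (val (a (shiftF i t)))) k ⟩
    ∑[ i < N ] (val (a i) *C conjC (val (a (shiftF i t)))) k         ≡⟨ ∑-rotate-pairs (λ x y → (val x *C conjC (val y)) k) a j s t ⟩
    ∑[ i < N ] (val (rotated (toℕ i)) *C conjC (val (rotated (toℕ i + t)))) k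
      ≡⟨ sum-cong-≗ {N} (λ i → val-*C-conjC-vanishes (one-end-zero (Finₚ.toℕ<n i)) k) ⟩
    ∑[ i < N ] 0ℤ                                                    ≡⟨ sum-replicate-zero N ⟩
    0ℤ                                                               ∎)
    where
    one-end-zero : ∀ {m} → m < N → rotated m ≡ nothing ⊎ rotated (m + t) ≡ nothing
    one-end-zero {m} m<N with m ℕₚ.<? n
    ... | yes m<n = inj₂ (rotated-zero (ℕₚ.≤-trans n≤t (ℕₚ.m≤n+m t m)) (ℕₚ.+-mono-<-≤ m<n t≤s))
    ... | no m≮n  = inj₁ (rotated-zero (ℕₚ.≮⇒≥ m≮n) m<N)

  autocorr-distinct : ∀ {t u} → t < u → u ≤ s → u ≤ n → u ∸ t < p → ¬ autocorr a t ≈C autocorr a u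
  autocorr-distinct {t} {u} t<u u≤s u≤n u∸t<p Ct≈Cu =
    >⇒∤ {{ℕ.>-nonZero (ℕₚ.m<n⇒0<n∸m t<u)}} u∸t<p (subst (+ p ∣ℤ_) difference (≈C⇒∣augmentation-difference Ct≈Cu))
    where
    t≤u : t ≤ u
    t≤u = ℕₚ.<⇒≤ t<u
    n∸t≡n∸u+u∸t : n ∸ t ≡ n ∸ u + (u ∸ t)
    n∸t≡n∸u+u∸t = trans (cong (_∸ t) (sym (ℕₚ.m∸n+n≡m u≤n))) (ℕₚ.+-∸-assoc (n ∸ u) t≤u)
    difference : augmentation (autocorr a t) -ℤ augmentation (autocorr a u) ≡ + (u ∸ t)
    difference = begin
      augmentation (autocorr a t) -ℤ augmentation (autocorr a u)
        ≡⟨ cong₂ _-ℤ_ (augmentation-autocorr-within-block (ℕₚ.≤-trans t≤u u≤s)) (augmentation-autocorr-within-block u≤s) ⟩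
      + (n ∸ t) -ℤ + (n ∸ u)    ≡⟨ ℤₚ.[+m]-[+n]≡m⊖n (n ∸ t) (n ∸ u) ⟩
      (n ∸ t) ⊖ (n ∸ u)         ≡⟨ ℤₚ.⊖-≥ (ℕₚ.∸-monoʳ-≤ n t≤u) ⟩
      + ((n ∸ t) ∸ (n ∸ u))     ≡⟨ cong (λ x → + (x ∸ (n ∸ u))) n∸t≡n∸u+u∸t ⟩
      + (n ∸ u + (u ∸ t) ∸ (n ∸ u)) ≡⟨ cong +_ (ℕₚ.m+n∸m≡n (n ∸ u) (u ∸ t)) ⟩
      + (u ∸ t)                 ∎

  autocorr-listed : ∀ {t} → t < n-1 + s → Any (autocorr a (suc t) ≈C_) (map (autocorr a) (shifts N))
  autocorr-listed {t} t<K = Any.map (λ { refl → ≈C.refl {p} {autocorr a (suc t)} })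
                                (∈-map⁺ (autocorr a) (∈-applyUpTo⁺ suc t<K))

  distinctCorr-≥ : s ⊓ p ⊓ n ≤ distinctCorr a
  distinctCorr-≥ = ≤-length-deduplicate ≈C-isEquivalence _≈C?_ (map (autocorr a) (shifts N)) C listed injective
    where
    m : ℕ
    m = s ⊓ p ⊓ n
    m≤s : m ≤ s
    m≤s = ℕₚ.≤-trans (ℕₚ.m⊓n≤m (s ⊓ p) n) (ℕₚ.m⊓n≤m s p)
    m≤p : m ≤ p
    m≤p = ℕₚ.≤-trans (ℕₚ.m⊓n≤m (s ⊓ p) n) (ℕₚ.m⊓n≤n s p)
    C : Fin m → Cyc p
    C i = autocorr a (suc (toℕ i))
    listed : ∀ i → Any (C i ≈C_) (map (autocorr a) (shifts N))
    listed i = autocorr-listed (ℕₚ.<-≤-trans (Finₚ.toℕ<n i) (ℕₚ.≤-trans m≤s (ℕₚ.m≤n+m s n-1)))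
    distinct : ∀ {i k : Fin m} → toℕ i < toℕ k → ¬ C i ≈C C k
    distinct {i} {k} i<k = autocorr-distinct (s≤s i<k) (ℕₚ.≤-trans (Finₚ.toℕ<n k) m≤s)
      (ℕₚ.≤-trans (Finₚ.toℕ<n k) (ℕₚ.m⊓n≤n (s ⊓ p) n))
      (ℕₚ.≤-<-trans (ℕₚ.m∸n≤m (toℕ k) (toℕ i)) (ℕₚ.<-≤-trans (Finₚ.toℕ<n k) m≤p))
    injective : ∀ {i k} → C i ≈C C k → i ≡ k
    injective {i} {k} Ci≈Ck with Finₚ.<-cmp i k
    ... | tri< i<k _ _ = contradiction Ci≈Ck (distinct i<k)
    ... | tri≈ _ i≡k _ = i≡k
    ... | tri> _ _ k<i = contradiction (≈C.sym {p} {C i} {C k} Ci≈Ck) (distinct k<i)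

  distinctCorr-≤-period : distinctCorr a ≤ n-1 + s
  distinctCorr-≤-period =
    subst (distinctCorr a ≤_) (trans (Listₚ.length-map (autocorr a) (shifts N)) (Listₚ.length-applyUpTo suc (n-1 + s)))
          (Listₚ.length-deduplicate _≈C?_ (map (autocorr a) (shifts N)))

  -- Shifts n ≤ t ≤ s all give C(t) ≈ 0, so only C(1), …, C(n-1), C(s), …, C(N-1) can be new.
  distinctCorr-≤-long-block : n ≤ s → distinctCorr a ≤ n-1 + n
  distinctCorr-≤-long-block n≤s = subst (λ xs → length (deduplicate _≈C?_ xs) ≤ n-1 + n) (sym listing)
    (ℕₚ.≤-trans front-counted (ℕₚ.+-monoʳ-≤ n-1 middle-absorbed))
    where
    C : ℕ → Cyc p
    C = autocorr a
    e : ℕ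
    e = s ∸ n
    front middle back : List (Cyc p)
    front  = applyUpTo (λ x → C (suc x)) n-1
    middle = applyUpTo (λ x → C (n + x)) e
    back   = applyUpTo (λ x → C (n + (e + x))) n
    n+e≡s : n + e ≡ s
    n+e≡s = ℕₚ.m+[n∸m]≡n n≤s
    listing : map C (shifts N) ≡ front ++ (middle ++ back)
    listing = begin
      map C (applyUpTo suc (n-1 + s))                              ≡⟨ Listₚ.map-applyUpTo suc C (n-1 + s) ⟩
      applyUpTo (C ∘ suc) (n-1 + s)                                ≡⟨ cong (λ k → applyUpTo (C ∘ suc) (n-1 + k)) (trans (sym n+e≡s) (ℕₚ.+-comm n e)) ⟩
      applyUpTo (C ∘ suc) (n-1 + (e + n))                          ≡⟨ applyUpTo-++ (C ∘ suc) n-1 (e + n) ⟩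
      front ++ applyUpTo (λ x → C (n + x)) (e + n)                 ≡⟨ cong (front ++_) (applyUpTo-++ (λ x → C (n + x)) e n) ⟩
      front ++ (middle ++ back)                                    ∎
    back-head-vanishes : C (n + (e + 0)) ≈C zeroC
    back-head-vanishes = subst (λ t → C t ≈C zeroC) (sym (trans (cong (λ x → n + x) (ℕₚ.+-identityʳ e)) n+e≡s))
                               (autocorr-vanishes n≤s ℕₚ.≤-refl)
    front-counted : length (deduplicate _≈C?_ (front ++ (middle ++ back))) ≤ n-1 + length (deduplicate _≈C?_ (middle ++ back))
    front-counted = ℕₚ.≤-trans (length-deduplicate-++ ≈C-isEquivalence _≈C?_ front (middle ++ back))
      (ℕₚ.+-monoˡ-≤ (length (deduplicate _≈C?_ (middle ++ back))) (ℕₚ.≤-reflexive (Listₚ.length-applyUpTo (λ x → C (suc x)) n-1)))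
    middle-redundant : All (λ x → Any (x ≈C_) back) middle
    middle-redundant = Allₚ.applyUpTo⁺₁ (λ x → C (n + x)) e (λ {x} x<e → here
      (≈C.trans {p} {C (n + x)} {zeroC} {C (n + (e + 0))}
        (autocorr-vanishes (ℕₚ.m≤m+n n x) (subst (n + x ≤_) n+e≡s (ℕₚ.+-monoʳ-≤ n (ℕₚ.<⇒≤ x<e))))
        (≈C.sym {p} {C (n + (e + 0))} {zeroC} back-head-vanishes)))
    middle-absorbed : length (deduplicate _≈C?_ (middle ++ back)) ≤ n
    middle-absorbed = ℕₚ.≤-trans (length-deduplicate-redundant ≈C-isEquivalence _≈C?_ middle back middle-redundant)
      (ℕₚ.≤-trans (Listₚ.length-deduplicate _≈C?_ back) (ℕₚ.≤-reflexive (Listₚ.length-applyUpTo (λ x → C (n + (e + x))) n)))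

  distinctCorr-≤ : distinctCorr a ≤ n ∸ 1 + n ⊓ s
  distinctCorr-≤ with ℕₚ.≤-total n s
  ... | inj₁ n≤s = subst (λ k → distinctCorr a ≤ n-1 + k) (sym (ℕₚ.m≤n⇒m⊓n≡m n≤s)) (distinctCorr-≤-long-block n≤s)
  ... | inj₂ s≤n = subst (λ k → distinctCorr a ≤ n-1 + k) (sym (ℕₚ.m≥n⇒m⊓n≡n s≤n)) distinctCorr-≤-period

-- Primality of p is what makes Cyc p a model of ℤ[ζ_p]; the counting argument itself does not use it.
theorem3p1 : (p n s : ℕ) → Prime p → 1 ≤ n →
    (a : Seq p (n + s)) → ZeroBlock a s →
    (s ⊓ p ⊓ n ≤ distinctCorr a) × (distinctCorr a ≤ n ∸ 1 + n ⊓ s)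
theorem3p1 p (suc n-1) s _ (s≤s z≤n) a (j , zeros) = distinctCorr-≥ , distinctCorr-≤
  where open WithZeroBlock a j zeros
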